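{- Let $D$ be a deck of order $n$ and let $k$ be a positive integer. Take any $kn+2$ distinct cards of $D$. Then on each of these cards there is a symbol which belongs to at least $k+2$ of these $kn+2$ cards.
   Context: A deck consists of a finite set $S$ of symbols together with a finite collection $D$ of distinct cards, each card being a subset of $S$, satisfying: (D1) any two distinct cards have exactly one symbol in common; (D2) every symbol of $S$ lies on at least two cards; (D3) every card contains at least two symbols; (D4) all cards have the same cardinality $n$ (the order); (D5) $S$ is nonempty. -}

module Defs where

open import Data.Nat using (ℕ; _≤_)
open import Data.Fin using (Fin)
open import Data.Fin.Subset using (Subset; _∈_; _∩_; ∣_∣)
open import Data.Fin.Subset.Properties using (_∈?_)
open import Data.Vec using (tabulate)
open import Data.Product using (∃; ∃₂; _×_)
open import Relation.Nullary using (¬_; does)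
open import Relation.Binary.PropositionalEquality using (_≡_; _≢_)
open import Function.Definitions using (Injective)

-- A deck with symbol set S = Fin s and card collection D indexed by Fin c.
-- Cards are subsets of S; distinctness of cards is injectivity of the indexing.
record IsDeck (s c n : ℕ) (card : Fin c → Subset s) : Set where
  field
    distinct : Injective _≡_ _≡_ card
    D1 : ∀ i j → i ≢ j → ∣ card i ∩ card j ∣ ≡ 1
    D2 : ∀ (x : Fin s) → ∃₂ λ i j → i ≢ j × x ∈ card i × x ∈ card j
    D3 : ∀ i → 2 ≤ ∣ card i ∣
    D4 : ∀ i → ∣ card i ∣ ≡ n
    D5 : 1 ≤ s

cardsContaining : ∀ {s c m} → (Fin c → Subset s) → (Fin m → Fin c) → Fin s → Subset m
cardsContaining card sel x = tabulate (λ j → does (x ∈? card (sel j)))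

-- Fix a selected card C. Every other selected card meets C in exactly one symbol, so counting
-- incidences between the n symbols of C and the m = kn + 2 selected cards gives n + (m - 1).
-- If each symbol of C lay on at most k + 1 selected cards, the count would be at most (k + 1)n,
-- which is one less than n + (m - 1).
module Submission where

open import Defs
open import Data.Nat using (ℕ; suc; pred; _≤_; _≰_; _+_; _*_; z≤n; _≤?_)
open import Data.Nat.Properties
  using (+-*-semiring; +-mono-≤; ≤-reflexive; ≤-trans; ≤-pred; ≰⇒>; +-suc; +-comm;
         *-identityˡ; *-identityʳ; +-cancelˡ-≤; m+1+n≰m; module ≤-Reasoning)
open import Data.Bool using (Bool; true; false; _∧_)
open import Data.Fin using (Fin; zero; suc; punchIn)
open import Data.Fin.Properties using (any?; punchInᵢ≢i)
open import Data.Fin.Subset using (Subset; _∈_; ∣_∣; _∩_; inside; outside)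
open import Data.Fin.Subset.Properties using (_∈?_; ∩-idem)
open import Data.Vec using ([]; _∷_; tabulate)
open import Data.Product using (∃; _×_; _,_)
open import Function using (_∘_)
open import Function.Definitions using (Injective)
open import Relation.Binary.PropositionalEquality
open import Relation.Nullary using (yes; no; does; contradiction)
open import Relation.Nullary.Decidable using (_×-dec_)
open import Algebra.Properties.Semiring.Sum +-*-semiring
  using (sum; sum-syntax; sum-cong-≗; sum-remove; ∑-comm; *-distribˡ-sum)

private
  variable
    s c m : ℕ

indicator : Bool → ℕ
indicator true  = 1
indicator false = 0

indicator-∧ : ∀ a b → indicator (a ∧ b) ≡ indicator a * indicator b
indicator-∧ true  b = sym (*-identityˡ (indicator b))
indicator-∧ false b = refl

infix 5 _∈ᵇ_

_∈ᵇ_ : Fin s → Subset s → Bool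
x ∈ᵇ p = does (x ∈? p)

∈ᵇ-∩ : ∀ (p q : Subset s) x → x ∈ᵇ p ∩ q ≡ (x ∈ᵇ p) ∧ (x ∈ᵇ q)
∈ᵇ-∩ (inside  ∷ p) (inside  ∷ q) zero    = refl
∈ᵇ-∩ (inside  ∷ p) (outside ∷ q) zero    = refl
∈ᵇ-∩ (outside ∷ p) (_       ∷ q) zero    = refl
∈ᵇ-∩ (_       ∷ p) (_       ∷ q) (suc x) = ∈ᵇ-∩ p q x

∈ᵇ-tabulate : ∀ (f : Fin s → Bool) x → x ∈ᵇ tabulate f ≡ f x
∈ᵇ-tabulate f zero    with f zero
... | true  = refl
... | false = refl
∈ᵇ-tabulate f (suc x) = ∈ᵇ-tabulate (f ∘ suc) x

∣p∣≡∑indicator : ∀ (p : Subset s) → ∣ p ∣ ≡ ∑[ x < s ] indicator (x ∈ᵇ p)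
∣p∣≡∑indicator []            = refl
∣p∣≡∑indicator (inside  ∷ p) = cong suc (∣p∣≡∑indicator p)
∣p∣≡∑indicator (outside ∷ p) = ∣p∣≡∑indicator p

∑-mono-≤ : {f g : Fin m → ℕ} → (∀ i → f i ≤ g i) → sum f ≤ sum g
∑-mono-≤ {m = 0}     f≤g = z≤n
∑-mono-≤ {m = suc m} f≤g = +-mono-≤ (f≤g zero) (∑-mono-≤ (f≤g ∘ suc))

∑-ones : {f : Fin m → ℕ} → (∀ i → f i ≡ 1) → sum f ≡ m
∑-ones {m = 0}     f≡1 = refl
∑-ones {m = suc m} f≡1 = cong₂ _+_ (f≡1 zero) (∑-ones (f≡1 ∘ suc))

∑-∣cardsContaining∣ : (card : Fin c → Subset s) (sel : Fin m → Fin c) (A : Subset s) →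
  ∑[ x < s ] (indicator (x ∈ᵇ A) * ∣ cardsContaining card sel x ∣) ≡
  ∑[ j < m ] ∣ A ∩ card (sel j) ∣
∑-∣cardsContaining∣ {s = s} {m = m} card sel A = begin
  ∑[ x < s ] ([ x ∈A] * ∣ cardsContaining card sel x ∣)
    ≡⟨ sum-cong-≗ (λ x → cong ([ x ∈A] *_) (∣cardsContaining∣ x)) ⟩
  ∑[ x < s ] ([ x ∈A] * ∑[ j < m ] [ x ∈card j ])
    ≡⟨ sum-cong-≗ (λ x → *-distribˡ-sum [ x ∈A] (λ j → [ x ∈card j ])) ⟩
  ∑[ x < s ] ∑[ j < m ] ([ x ∈A] * [ x ∈card j ])
    ≡⟨ ∑-comm (λ x j → [ x ∈A] * [ x ∈card j ]) ⟩
  ∑[ j < m ] ∑[ x < s ] ([ x ∈A] * [ x ∈card j ])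
    ≡⟨ sum-cong-≗ (λ j → sym (∣A∩card∣ j)) ⟩
  ∑[ j < m ] ∣ A ∩ card (sel j) ∣ ∎
  where
  open ≡-Reasoning
  [_∈A] : Fin s → ℕ
  [ x ∈A] = indicator (x ∈ᵇ A)
  [_∈card_] : Fin s → Fin m → ℕ
  [ x ∈card j ] = indicator (x ∈ᵇ card (sel j))
  ∣cardsContaining∣ : ∀ x → ∣ cardsContaining card sel x ∣ ≡ ∑[ j < m ] [ x ∈card j ]
  ∣cardsContaining∣ x = trans (∣p∣≡∑indicator (cardsContaining card sel x))
    (sum-cong-≗ (λ j → cong indicator (∈ᵇ-tabulate (λ j → x ∈ᵇ card (sel j)) j)))
  ∣A∩card∣ : ∀ j → ∣ A ∩ card (sel j) ∣ ≡ ∑[ x < s ] ([ x ∈A] * [ x ∈card j ])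
  ∣A∩card∣ j = trans (∣p∣≡∑indicator (A ∩ card (sel j)))
    (sum-cong-≗ (λ x → trans (cong indicator (∈ᵇ-∩ A (card (sel j)) x))
                             (indicator-∧ (x ∈ᵇ A) (x ∈ᵇ card (sel j)))))

∑-∣cardsContaining∣-≤ : (card : Fin c → Subset s) (sel : Fin m → Fin c) (A : Subset s) (r : ℕ) →
  (∀ x → x ∈ A → ∣ cardsContaining card sel x ∣ ≤ r) →
  ∑[ x < s ] (indicator (x ∈ᵇ A) * ∣ cardsContaining card sel x ∣) ≤ r * ∣ A ∣
∑-∣cardsContaining∣-≤ {s = s} card sel A r bounded = begin
  ∑[ x < s ] (indicator (x ∈ᵇ A) * ∣ cardsContaining card sel x ∣)
    ≤⟨ ∑-mono-≤ termwise ⟩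
  ∑[ x < s ] (r * indicator (x ∈ᵇ A))
    ≡⟨ *-distribˡ-sum r (λ x → indicator (x ∈ᵇ A)) ⟨
  r * ∑[ x < s ] indicator (x ∈ᵇ A)
    ≡⟨ cong (r *_) (∣p∣≡∑indicator A) ⟨
  r * ∣ A ∣ ∎
  where
  open ≤-Reasoning
  termwise : ∀ x → indicator (x ∈ᵇ A) * ∣ cardsContaining card sel x ∣ ≤ r * indicator (x ∈ᵇ A)
  termwise x with x ∈? A
  ... | yes x∈A = ≤-trans (≤-reflexive (*-identityˡ _))
                    (≤-trans (bounded x x∈A) (≤-reflexive (sym (*-identityʳ r))))
  ... | no  _   = z≤n

module _ {s c n} {card : Fin c → Subset s} (deck : IsDeck s c n card) where
  open IsDeck deck

  ∑-∣card∩card∣ : (sel : Fin m → Fin c) → Injective _≡_ _≡_ sel → (i : Fin m) →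
    ∑[ j < m ] ∣ card (sel i) ∩ card (sel j) ∣ ≡ n + pred m
  ∑-∣card∩card∣ {m = suc m} sel inj i = begin
    sum meet                               ≡⟨ sum-remove {i = i} meet ⟩
    meet i + ∑[ j < m ] meet (punchIn i j) ≡⟨ cong₂ _+_ meet-self (∑-ones meet-other) ⟩
    n + m                                  ∎
    where
    open ≡-Reasoning
    meet : Fin (suc m) → ℕ
    meet j = ∣ card (sel i) ∩ card (sel j) ∣
    meet-self : meet i ≡ n
    meet-self = trans (cong ∣_∣ (∩-idem (card (sel i)))) (D4 (sel i))
    meet-other : ∀ j → meet (punchIn i j) ≡ 1
    meet-other j = D1 (sel i) (sel (punchIn i j)) (punchInᵢ≢i i j ∘ sym ∘ inj)

  n+pred[m]≤r*n : (sel : Fin m → Fin c) → Injective _≡_ _≡_ sel → (i : Fin m) (r : ℕ) →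
    (∀ x → x ∈ card (sel i) → ∣ cardsContaining card sel x ∣ ≤ r) →
    n + pred m ≤ r * n
  n+pred[m]≤r*n {m = m} sel inj i r bounded = begin
    n + pred m
      ≡⟨ ∑-∣card∩card∣ sel inj i ⟨
    ∑[ j < m ] ∣ C ∩ card (sel j) ∣
      ≡⟨ ∑-∣cardsContaining∣ card sel C ⟨
    ∑[ x < s ] (indicator (x ∈ᵇ C) * ∣ cardsContaining card sel x ∣)
      ≤⟨ ∑-∣cardsContaining∣-≤ card sel C r bounded ⟩
    r * ∣ C ∣
      ≡⟨ cong (r *_) (D4 (sel i)) ⟩
    r * n ∎
    where
    open ≤-Reasoning
    C : Subset s
    C = card (sel i)

mainTheorem10 : ∀ {s c n} (card : Fin c → Subset s) → IsDeck s c n card →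
                (k : ℕ) → 1 ≤ k →
                (sel : Fin (k * n + 2) → Fin c) → Injective _≡_ _≡_ sel →
                ∀ (i : Fin (k * n + 2)) →
                  ∃ λ (x : Fin s) → x ∈ card (sel i) ×
                    k + 2 ≤ ∣ cardsContaining card sel x ∣
mainTheorem10 {n = n} card deck k _ sel inj i
  with any? (λ x → x ∈? card (sel i) ×-dec k + 2 ≤? ∣ cardsContaining card sel x ∣)
... | yes found = found
... | no  none  = contradiction (n+pred[m]≤r*n deck sel inj i (suc k) atMost[k+1]) tooMany
  where
  atMost[k+1] : ∀ x → x ∈ card (sel i) → ∣ cardsContaining card sel x ∣ ≤ suc k
  atMost[k+1] x x∈C = ≤-pred (subst (suc ∣ cardsContaining card sel x ∣ ≤_) (+-comm k 2)
                                    (≰⇒> (λ many → none (x , x∈C , many))))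
  tooMany : n + pred (k * n + 2) ≰ suc k * n
  tooMany le = m+1+n≰m (k * n)
    (+-cancelˡ-≤ n _ _ (subst (λ p → n + p ≤ n + k * n) (cong pred (+-suc (k * n) 1)) le))
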